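{- Let $a,b$ be fixed positive coprime integers and $g$ a positive integer. For all integers $j,k$ with $0\le j<g$ and $j(a+b)\le k<(j+1)(a+b)$ we have $|N_k(g)|=\mu_j(g)$, where $\mu_j(g):=|N_{j(a+b)}(g)|$.
   Context: Lattice paths take steps in $\{(1,0),(0,1)\}$. The points of a path are the lattice points it visits, including its startpoint and endpoint. A flaw of a path is a point of the path lying strictly above the line segment joining its startpoint to its endpoint. $N_k(g)$ denotes the set of paths from $(0,0)$ to $(ga,gb)$ having exactly $k$ flaws. -}

module Defs where

open import Data.Nat using (ℕ; zero; suc; _+_; _*_; _<_; _<ᵇ_)
open import Data.Bool using (Bool; true; false; if_then_else_)
open import Data.List using (List; []; _∷_; map; _++_; length; filterᵇ)
open import Data.Product using (_×_; _,_)
open import Relation.Binary.PropositionalEquality using (_≡_)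

-- A step: true = (1,0) (east), false = (0,1) (north).
Step : Set
Step = Bool

allWords : ℕ → List (List Step)
allWords zero = [] ∷ []
allWords (suc n) = map (true ∷_) (allWords n) ++ map (false ∷_) (allWords n)

endFrom : ℕ × ℕ → List Step → ℕ × ℕ
endFrom p [] = p
endFrom (x , y) (true ∷ s) = endFrom (suc x , y) s
endFrom (x , y) (false ∷ s) = endFrom (x , suc y) s

pointsFrom : ℕ × ℕ → List Step → List (ℕ × ℕ)
pointsFrom p [] = p ∷ []
pointsFrom (x , y) (true ∷ s) = (x , y) ∷ pointsFrom (suc x , y) s
pointsFrom (x , y) (false ∷ s) = (x , y) ∷ pointsFrom (x , suc y) s

-- (x , y) lies strictly above the segment from (0,0) to (A , B) (A > 0):
-- y > (B / A) x, i.e. x * B < y * A.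
aboveᵇ : ℕ → ℕ → ℕ × ℕ → Bool
aboveᵇ A B (x , y) = (x * B) <ᵇ (y * A)

flaws : ℕ → ℕ → List Step → ℕ
flaws A B s = length (filterᵇ (aboveᵇ A B) (pointsFrom (0 , 0) s))

eqPairᵇ : ℕ × ℕ → ℕ × ℕ → Bool
eqPairᵇ (x , y) (u , v) = (x Data.Nat.≡ᵇ u) Data.Bool.∧ (y Data.Nat.≡ᵇ v)
  where import Data.Nat ; import Data.Bool

N : ℕ → ℕ → ℕ → ℕ → List (List Step)
N a b k g =
  filterᵇ (λ s → eqPairᵇ (endFrom (0 , 0) s) (g * a , g * b)
                 Data.Bool.∧ (flaws (g * a) (g * b) s Data.Nat.≡ᵇ k))
          (allWords (g * a + g * b))
  where import Data.Nat ; import Data.Bool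

cardN : ℕ → ℕ → ℕ → ℕ → ℕ
cardN a b k g = length (N a b k g)

μ : ℕ → ℕ → ℕ → ℕ → ℕ
μ a b j g = cardN a b (j * (a + b)) g

{-# OPTIONS --safe #-}
module Submission where

-- Put A = g a, B = g b and give the point (x , y) the level y A − x B, so that the flaws of a path
-- are its points of positive level.  Let firstPeak w be the index of the first point of w of maximal
-- level.  Induction on the last step shows that (endpoint, number of flaws) and (endpoint, firstPeak)
-- are equidistributed: a last step onto a flaw adds a flaw, and the same step placed first instead
-- adds one to firstPeak; a last step onto a non-flaw changes neither.  For paths to (A , B), moving
-- the first step to the end lowers firstPeak by one, unless the path peaks at its start; in that
-- case, if the rotated path has firstPeak k, the path returns to level 0 after k + 1 steps, and by
-- coprimality such lengths are multiples of a + b.  So the number of paths to (A , B) with firstPeak k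
-- only changes from k to k + 1 when a + b divides k + 1.

open import Defs

import Algebra.Properties.AbelianGroup as AbelianGroupProperties
import Algebra.Properties.CommutativeSemigroup as CommutativeSemigroupProperties
open import Data.Bool using (Bool; true; false; not; _∧_; T)
open import Data.Bool.Properties using (T-≡; T-∧)
open import Data.Integer as ℤ using (ℤ; +_; -_; 0ℤ; _-_; _⊔_; _⊖_; _<?_)
open import Data.Integer.Properties
  using (≤-refl; ≤-reflexive; ≤-trans; <-≤-trans; <⇒≤; ≮⇒≥; ≤-antisym; <⇒≢; +-monoʳ-≤; +-identityˡ;
         +-identityʳ; +-assoc; +-comm; +-inverseʳ; +-injective; i-j≡0⇒i≡j; pos-+; +-0-abelianGroup;
         i≤i⊔j; i≤j⊔i; i≤j⇒i⊔j≡j; i≥j⇒i⊔j≡i; ⊔-assoc; mono-≤-distrib-⊔;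
         [+m]-[+n]≡m⊖n; n⊖n≡0; ⊖-monoˡ-<; ⊖-monoˡ-≤; module ≤-Reasoning)
open import Data.Integer.Tactic.RingSolver using (solve-∀)
open import Data.List using (List; []; _∷_; _∷ʳ_; _++_; map; length; take; filterᵇ)
open import Data.List.Properties using (filter-++; length-++; length-take)
open import Data.List.Relation.Unary.All using (All; []; _∷_; universal)
open import Data.Nat using (ℕ; zero; suc; _+_; _*_; _∸_; _≤_; _<_; _≡ᵇ_; z≤n; s≤s; NonZero; >-nonZero)
open import Data.Nat.Coprimality using (Coprime; coprime-divisor; gcd≡1⇒coprime)
open import Data.Nat.Divisibility using (_∣_; divides; quotient; ∣m+n∣m⇒∣n; ∣⇒≤; n∣m*n)
open import Data.Nat.GCD using (gcd)
import Data.Nat.Properties as ℕ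
open import Data.Product using (_×_; _,_; proj₁; proj₂)
open import Function using (_∘_; Equivalence)
open import Relation.Binary.PropositionalEquality
  using (_≡_; _≢_; refl; sym; trans; cong; cong₂; subst; subst₂; module ≡-Reasoning)
open import Relation.Nullary using (¬_; yes; no; contradiction)
open import Relation.Nullary.Decidable using (T?; dec-false)

open AbelianGroupProperties +-0-abelianGroup using (∙-cancelˡ)
open CommutativeSemigroupProperties ℕ.+-commutativeSemigroup using (interchange)
open CommutativeSemigroupProperties ℕ.*-commutativeSemigroup using (x∙yz≈y∙xz; xy∙z≈xz∙y)

private variable
  X Y : Set

countᵇ : (X → Bool) → List X → ℕ
countᵇ p xs = length (filterᵇ p xs)

countᵇ-++ : ∀ p (xs ys : List X) → countᵇ p (xs ++ ys) ≡ countᵇ p xs + countᵇ p ys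
countᵇ-++ p xs ys = trans (cong length (filter-++ (T? ∘ p) xs ys)) (length-++ (filterᵇ p xs))

countᵇ-map : ∀ p (f : Y → X) xs → countᵇ p (map f xs) ≡ countᵇ (p ∘ f) xs
countᵇ-map p f [] = refl
countᵇ-map p f (x ∷ xs) with p (f x)
... | true  = cong suc (countᵇ-map p f xs)
... | false = countᵇ-map p f xs

countᵇ-cong : ∀ {p q : X → Bool} {xs} → All (λ x → p x ≡ q x) xs → countᵇ p xs ≡ countᵇ q xs
countᵇ-cong [] = refl
countᵇ-cong {p = p} {q} {x ∷ _} (px≡qx ∷ p≗q) with p x | q x | px≡qx
... | true  | .true  | refl = cong suc (countᵇ-cong p≗q)
... | false | .false | refl = countᵇ-cong p≗q

countᵇ-split : ∀ (q p : X → Bool) xs →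
  countᵇ p xs ≡ countᵇ (λ x → q x ∧ p x) xs + countᵇ (λ x → not (q x) ∧ p x) xs
countᵇ-split q p [] = refl
countᵇ-split q p (x ∷ xs) with q x | p x
... | true  | true  = cong suc (countᵇ-split q p xs)
... | true  | false = countᵇ-split q p xs
... | false | true  = trans (cong suc (countᵇ-split q p xs)) (sym (ℕ.+-suc _ _))
... | false | false = countᵇ-split q p xs

rotate : List X → List X
rotate []       = []
rotate (x ∷ xs) = xs ∷ʳ x

sumSteps : (Step → ℕ) → ℕ
sumSteps f = f true + f false

sumSteps-cong : ∀ {f g : Step → ℕ} → (∀ s → f s ≡ g s) → sumSteps f ≡ sumSteps g
sumSteps-cong f≗g = cong₂ _+_ (f≗g true) (f≗g false)

count : (List Step → Bool) → ℕ → ℕ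
count p n = countᵇ p (allWords n)

count-cong : ∀ {p q : List Step → Bool} → (∀ w → p w ≡ q w) → ∀ n → count p n ≡ count q n
count-cong p≗q n = countᵇ-cong (universal p≗q (allWords n))

count₀-cong : ∀ p q → p [] ≡ q [] → count p zero ≡ count q zero
count₀-cong p q p[]≡q[] = countᵇ-cong {p = p} {q} (p[]≡q[] ∷ [])

count-∷ : ∀ p n → count p (suc n) ≡ sumSteps (λ s → count (p ∘ (s ∷_)) n)
count-∷ p n = trans (countᵇ-++ p (map (true ∷_) (allWords n)) (map (false ∷_) (allWords n)))
                    (cong₂ _+_ (countᵇ-map p _ (allWords n)) (countᵇ-map p _ (allWords n)))

count-∷ʳ : ∀ p n → count p (suc n) ≡ sumSteps (λ s → count (λ w → p (w ∷ʳ s)) n)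
count-∷ʳ p zero = trans (count-∷ p zero)
  (cong₂ _+_ (count₀-cong (p ∘ (true ∷_)) (λ w → p (w ∷ʳ true)) refl)
             (count₀-cong (p ∘ (false ∷_)) (λ w → p (w ∷ʳ false)) refl))
count-∷ʳ p (suc n) = begin
  count p (suc (suc n))
    ≡⟨ count-∷ p (suc n) ⟩
  sumSteps (λ s → count (p ∘ (s ∷_)) (suc n))
    ≡⟨ cong₂ _+_ (count-∷ʳ (p ∘ (true ∷_)) n) (count-∷ʳ (p ∘ (false ∷_)) n) ⟩
  sumSteps (λ s → sumSteps (λ t → count (λ w → p (s ∷ w ∷ʳ t)) n))
    ≡⟨ interchange (count (λ w → p (true ∷ w ∷ʳ true)) n) (count (λ w → p (true ∷ w ∷ʳ false)) n)
                   (count (λ w → p (false ∷ w ∷ʳ true)) n) (count (λ w → p (false ∷ w ∷ʳ false)) n) ⟩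
  sumSteps (λ t → sumSteps (λ s → count (λ w → p (s ∷ w ∷ʳ t)) n))
    ≡⟨ cong₂ _+_ (count-∷ (λ w → p (w ∷ʳ true)) n) (count-∷ (λ w → p (w ∷ʳ false)) n) ⟨
  sumSteps (λ t → count (λ w → p (w ∷ʳ t)) (suc n)) ∎
  where open ≡-Reasoning

count-rotate : ∀ p n → count p n ≡ count (p ∘ rotate) n
count-rotate p zero    = count₀-cong p (p ∘ rotate) refl
count-rotate p (suc n) = trans (count-∷ʳ p n) (sym (count-∷ (p ∘ rotate) n))

0⊔-pos : ∀ {i} → 0ℤ ℤ.< i → 0ℤ ⊔ i ≡ i
0⊔-pos 0<i = i≤j⇒i⊔j≡j (<⇒≤ 0<i)

0⊔-nonpos : ∀ {i} → ¬ 0ℤ ℤ.< i → 0ℤ ⊔ i ≡ 0ℤ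
0⊔-nonpos 0≮i = i≥j⇒i⊔j≡i (≮⇒≥ 0≮i)

module Peaks {S : Set} (rise : S → ℤ) where

  height : List S → ℤ
  height []      = 0ℤ
  height (x ∷ w) = rise x ℤ.+ height w

  peak : List S → ℤ
  peak []      = 0ℤ
  peak (x ∷ w) = 0ℤ ⊔ (rise x ℤ.+ peak w)

  -- The index of the first point of maximal height, the walk starting at height 0.
  firstPeak : List S → ℕ
  firstPeak []      = 0
  firstPeak (x ∷ w) with 0ℤ <? rise x ℤ.+ peak w
  ... | yes _ = suc (firstPeak w)
  ... | no  _ = 0

  0≤peak : ∀ w → 0ℤ ℤ.≤ peak w
  0≤peak []      = ≤-refl
  0≤peak (x ∷ w) = i≤i⊔j 0ℤ _

  height≤peak : ∀ w → height w ℤ.≤ peak w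
  height≤peak []      = ≤-refl
  height≤peak (x ∷ w) = ≤-trans (+-monoʳ-≤ (rise x) (height≤peak w)) (i≤j⊔i 0ℤ _)

  height-∷ʳ : ∀ w x → height (w ∷ʳ x) ≡ height w ℤ.+ rise x
  height-∷ʳ []      x = trans (+-identityʳ (rise x)) (sym (+-identityˡ (rise x)))
  height-∷ʳ (y ∷ w) x =
    trans (cong (ℤ._+_ (rise y)) (height-∷ʳ w x)) (sym (+-assoc (rise y) (height w) (rise x)))

  height-rotate : ∀ x w → height (w ∷ʳ x) ≡ height (x ∷ w)
  height-rotate x w = trans (height-∷ʳ w x) (+-comm (height w) (rise x))

  peak-∷ʳ : ∀ w x → peak (w ∷ʳ x) ≡ peak w ⊔ height (w ∷ʳ x)
  peak-∷ʳ []      x = refl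
  peak-∷ʳ (y ∷ w) x = begin
    0ℤ ⊔ (rise y ℤ.+ peak (w ∷ʳ x))
      ≡⟨ cong (λ m → 0ℤ ⊔ (rise y ℤ.+ m)) (peak-∷ʳ w x) ⟩
    0ℤ ⊔ (rise y ℤ.+ (peak w ⊔ height (w ∷ʳ x)))
      ≡⟨ cong (0ℤ ⊔_) (mono-≤-distrib-⊔ (+-monoʳ-≤ (rise y)) (peak w) (height (w ∷ʳ x))) ⟩
    0ℤ ⊔ ((rise y ℤ.+ peak w) ⊔ (rise y ℤ.+ height (w ∷ʳ x)))
      ≡⟨ ⊔-assoc 0ℤ _ _ ⟨
    (0ℤ ⊔ (rise y ℤ.+ peak w)) ⊔ (rise y ℤ.+ height (w ∷ʳ x)) ∎
    where open ≡-Reasoning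

  peak-∷ʳ-≤ : ∀ w x → height (w ∷ʳ x) ℤ.≤ peak w → peak (w ∷ʳ x) ≡ peak w
  peak-∷ʳ-≤ w x h≤p = trans (peak-∷ʳ w x) (i≥j⇒i⊔j≡i h≤p)

  firstPeak-∷ : ∀ x w → 0ℤ ℤ.< height (x ∷ w) → firstPeak (x ∷ w) ≡ suc (firstPeak w)
  firstPeak-∷ x w 0<h with 0ℤ <? rise x ℤ.+ peak w
  ... | yes _   = refl
  ... | no  0≮p = contradiction (<-≤-trans 0<h (+-monoʳ-≤ (rise x) (height≤peak w))) 0≮p

  firstPeak-∷ʳ : ∀ w x → peak (w ∷ʳ x) ≡ peak w → firstPeak (w ∷ʳ x) ≡ firstPeak w
  firstPeak-∷ʳ [] x eq with 0ℤ <? rise x ℤ.+ 0ℤ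
  ... | yes 0<r = contradiction (trans (sym eq) (0⊔-pos 0<r)) (<⇒≢ 0<r)
  ... | no  _   = refl
  firstPeak-∷ʳ (y ∷ w) x eq with 0ℤ <? rise y ℤ.+ peak (w ∷ʳ x) | 0ℤ <? rise y ℤ.+ peak w
  ... | yes 0<p′ | yes 0<p = cong suc (firstPeak-∷ʳ w x
          (∙-cancelˡ (rise y) _ _ (trans (sym (0⊔-pos 0<p′)) (trans eq (0⊔-pos 0<p)))))
  ... | yes 0<p′ | no  0≮p =
          contradiction (trans (sym (trans eq (0⊔-nonpos 0≮p))) (0⊔-pos 0<p′)) (<⇒≢ 0<p′)
  ... | no  0≮p′ | yes 0<p =
          contradiction (trans (sym (trans (sym eq) (0⊔-nonpos 0≮p′))) (0⊔-pos 0<p)) (<⇒≢ 0<p)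
  ... | no  _    | no  _   = refl

  firstPeak≤length : ∀ w → firstPeak w ≤ length w
  firstPeak≤length []      = z≤n
  firstPeak≤length (x ∷ w) with 0ℤ <? rise x ℤ.+ peak w
  ... | yes _ = s≤s (firstPeak≤length w)
  ... | no  _ = z≤n

  height-take-firstPeak : ∀ w → height (take (firstPeak w) w) ≡ peak w
  height-take-firstPeak []      = refl
  height-take-firstPeak (x ∷ w) with 0ℤ <? rise x ℤ.+ peak w
  ... | yes 0<p = trans (cong (ℤ._+_ (rise x)) (height-take-firstPeak w)) (sym (0⊔-pos 0<p))
  ... | no  0≮p = sym (0⊔-nonpos 0≮p)

  -- If x ∷ w peaks only at its start, x ∷ take (firstPeak w) w returns to height 0.
  firstPeak-rotate : ∀ {k} x w → height (x ∷ w) ≡ 0ℤ → (∀ u → height u ≡ 0ℤ → length u ≢ suc k) →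
    (firstPeak (w ∷ʳ x) ≡ᵇ k) ≡ (firstPeak (x ∷ w) ≡ᵇ suc k)
  firstPeak-rotate {k} x w h≡0 noReturn
    rewrite firstPeak-∷ʳ w x
              (peak-∷ʳ-≤ w x (≤-trans (≤-reflexive (trans (height-rotate x w) h≡0)) (0≤peak w)))
    with 0ℤ <? rise x ℤ.+ peak w
  ... | yes _   = refl
  ... | no  0≮p = dec-false (firstPeak w ℕ.≟ k) λ firstPeak≡k →
      noReturn (x ∷ take (firstPeak w) w) returns
        (cong suc (trans (length-take _ w) (trans (ℕ.m≤n⇒m⊓n≡m (firstPeak≤length w)) firstPeak≡k)))
    where
    returns : height (x ∷ take (firstPeak w) w) ≡ 0ℤ
    returns = trans (cong (ℤ._+_ (rise x)) (height-take-firstPeak w))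
      (≤-antisym (≮⇒≥ 0≮p) (≤-trans (≤-reflexive (sym h≡0)) (+-monoʳ-≤ (rise x) (height≤peak w))))

step : ℕ × ℕ → Step → ℕ × ℕ
step (x , y) true  = suc x , y
step (x , y) false = x , suc y

endFrom-∷ : ∀ p s w → endFrom p (s ∷ w) ≡ endFrom (step p s) w
endFrom-∷ p true  w = refl
endFrom-∷ p false w = refl

endFrom-step : ∀ p s w → endFrom (step p s) w ≡ step (endFrom p w) s
endFrom-step p s     []          = refl
endFrom-step p true  (true ∷ w)  = endFrom-step _ true w
endFrom-step p true  (false ∷ w) = endFrom-step _ true w
endFrom-step p false (true ∷ w)  = endFrom-step _ false w
endFrom-step p false (false ∷ w) = endFrom-step _ false w

endFrom-∷ʳ : ∀ p w s → endFrom p (w ∷ʳ s) ≡ step (endFrom p w) s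
endFrom-∷ʳ p []          s = endFrom-∷ p s []
endFrom-∷ʳ p (true ∷ w)  s = endFrom-∷ʳ _ w s
endFrom-∷ʳ p (false ∷ w) s = endFrom-∷ʳ _ w s

endFrom-rotate : ∀ p w → endFrom p (rotate w) ≡ endFrom p w
endFrom-rotate p []      = refl
endFrom-rotate p (s ∷ w) =
  trans (endFrom-∷ʳ p w s) (trans (sym (endFrom-step p s w)) (sym (endFrom-∷ p s w)))

endFrom-length : ∀ p w → proj₁ (endFrom p w) + proj₂ (endFrom p w) ≡ proj₁ p + proj₂ p + length w
endFrom-length p       []          = sym (ℕ.+-identityʳ _)
endFrom-length (x , y) (true ∷ w)  = trans (endFrom-length _ w) (sym (ℕ.+-suc (x + y) (length w)))
endFrom-length (x , y) (false ∷ w) =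
  trans (endFrom-length _ w)
        (trans (cong (_+ length w) (ℕ.+-suc x y)) (sym (ℕ.+-suc (x + y) (length w))))

pointsFrom-∷ʳ : ∀ p w s → pointsFrom p (w ∷ʳ s) ≡ pointsFrom p w ∷ʳ endFrom p (w ∷ʳ s)
pointsFrom-∷ʳ p []          true  = refl
pointsFrom-∷ʳ p []          false = refl
pointsFrom-∷ʳ p (true ∷ w)  s     = cong (p ∷_) (pointsFrom-∷ʳ _ w s)
pointsFrom-∷ʳ p (false ∷ w) s     = cong (p ∷_) (pointsFrom-∷ʳ _ w s)

eqPairᵇ⇒≡ : ∀ p q → eqPairᵇ p q ≡ true → p ≡ q
eqPairᵇ⇒≡ (x , y) (u , v) p≡q with Equivalence.to T-∧ (Equivalence.from T-≡ p≡q)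
... | x≡u , y≡v = cong₂ _,_ (ℕ.≡ᵇ⇒≡ x u x≡u) (ℕ.≡ᵇ⇒≡ y v y≡v)

module Lattice (A B : ℕ) where

  rise : Step → ℤ
  rise true  = - + B
  rise false = + A

  open Peaks rise public

  end : List Step → ℕ × ℕ
  end = endFrom (0 , 0)

  end-∷ : ∀ s w → end (s ∷ w) ≡ step (end w) s
  end-∷ s w = trans (endFrom-∷ (0 , 0) s w) (endFrom-step (0 , 0) s w)

  end-∷ʳ : ∀ w s → end (w ∷ʳ s) ≡ step (end w) s
  end-∷ʳ = endFrom-∷ʳ (0 , 0)

  level : ℕ × ℕ → ℤ
  level (x , y) = + (y * A) - + (x * B)

  level-step : ∀ p s → level (step p s) ≡ level p ℤ.+ rise s
  level-step (x , y) true  rewrite pos-+ B (x * B) = shuffle (+ (y * A)) (+ B) (+ (x * B))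
    where
    shuffle : ∀ i j k → i - (j ℤ.+ k) ≡ (i - k) ℤ.+ (- j)
    shuffle = solve-∀
  level-step (x , y) false rewrite pos-+ A (y * A) = shuffle (+ A) (+ (y * A)) (+ (x * B))
    where
    shuffle : ∀ i j k → (i ℤ.+ j) - k ≡ (j - k) ℤ.+ i
    shuffle = solve-∀

  level-endFrom : ∀ p w → level (endFrom p w) ≡ level p ℤ.+ height w
  level-endFrom p []      = sym (+-identityʳ (level p))
  level-endFrom p (s ∷ w) = begin
    level (endFrom p (s ∷ w))         ≡⟨ cong level (endFrom-∷ p s w) ⟩
    level (endFrom (step p s) w)      ≡⟨ level-endFrom (step p s) w ⟩
    level (step p s) ℤ.+ height w     ≡⟨ cong (ℤ._+ height w) (level-step p s) ⟩
    level p ℤ.+ rise s ℤ.+ height w   ≡⟨ +-assoc (level p) (rise s) (height w) ⟩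
    level p ℤ.+ height (s ∷ w)        ∎
    where open ≡-Reasoning

  level-end : ∀ w → level (end w) ≡ height w
  level-end w = trans (level-endFrom (0 , 0) w) (+-identityˡ (height w))

  level-corner : level (A , B) ≡ 0ℤ
  level-corner rewrite ℕ.*-comm B A = +-inverseʳ (+ (A * B))

  0<level : ∀ p → aboveᵇ A B p ≡ true → 0ℤ ℤ.< level p
  0<level (x , y) above = begin-strict
    0ℤ              ≡⟨ n⊖n≡0 (x * B) ⟨
    x * B ⊖ x * B   <⟨ ⊖-monoˡ-< (x * B) (ℕ.<ᵇ⇒< (x * B) (y * A) (Equivalence.from T-≡ above)) ⟩
    y * A ⊖ x * B   ≡⟨ [+m]-[+n]≡m⊖n (y * A) (x * B) ⟨
    level (x , y)   ∎
    where open ≤-Reasoning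

  level≤0 : ∀ p → aboveᵇ A B p ≡ false → level p ℤ.≤ 0ℤ
  level≤0 (x , y) below = begin
    level (x , y)   ≡⟨ [+m]-[+n]≡m⊖n (y * A) (x * B) ⟩
    y * A ⊖ x * B   ≤⟨ ⊖-monoˡ-≤ (x * B) (ℕ.≮⇒≥ λ xB<yA → subst T below (ℕ.<⇒<ᵇ xB<yA)) ⟩
    x * B ⊖ x * B   ≡⟨ n⊖n≡0 (x * B) ⟩
    0ℤ              ∎
    where open ≤-Reasoning

  returns-proportional : ∀ u → height u ≡ 0ℤ → proj₂ (end u) * A ≡ proj₁ (end u) * B
  returns-proportional u h≡0 = +-injective (i-j≡0⇒i≡j _ _ (trans (level-end u) h≡0))

  flaws-∷ʳ : ∀ w s → flaws A B (w ∷ʳ s) ≡ flaws A B w + countᵇ (aboveᵇ A B) (step (end w) s ∷ [])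
  flaws-∷ʳ w s = begin
    countᵇ (aboveᵇ A B) (pointsFrom (0 , 0) (w ∷ʳ s))
      ≡⟨ cong (countᵇ (aboveᵇ A B)) (pointsFrom-∷ʳ (0 , 0) w s) ⟩
    countᵇ (aboveᵇ A B) (pointsFrom (0 , 0) w ∷ʳ end (w ∷ʳ s))
      ≡⟨ countᵇ-++ (aboveᵇ A B) (pointsFrom (0 , 0) w) _ ⟩
    flaws A B w + countᵇ (aboveᵇ A B) (end (w ∷ʳ s) ∷ [])
      ≡⟨ cong (λ q → flaws A B w + countᵇ (aboveᵇ A B) (q ∷ [])) (end-∷ʳ w s) ⟩
    flaws A B w + countᵇ (aboveᵇ A B) (step (end w) s ∷ []) ∎
    where open ≡-Reasoning

  flaws-∷ʳ-above : ∀ w s → aboveᵇ A B (step (end w) s) ≡ true → flaws A B (w ∷ʳ s) ≡ suc (flaws A B w)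
  flaws-∷ʳ-above w s above rewrite flaws-∷ʳ w s | above = ℕ.+-comm (flaws A B w) 1

  flaws-∷ʳ-below : ∀ w s → aboveᵇ A B (step (end w) s) ≡ false → flaws A B (w ∷ʳ s) ≡ flaws A B w
  flaws-∷ʳ-below w s below rewrite flaws-∷ʳ w s | below = ℕ.+-identityʳ (flaws A B w)

  firstPeak-∷-above : ∀ s w → aboveᵇ A B (step (end w) s) ≡ true → firstPeak (s ∷ w) ≡ suc (firstPeak w)
  firstPeak-∷-above s w above =
    firstPeak-∷ s w (subst (0ℤ ℤ.<_) level≡height (0<level (step (end w) s) above))
    where
    level≡height : level (step (end w) s) ≡ height (s ∷ w)
    level≡height = trans (cong level (sym (end-∷ s w))) (level-end (s ∷ w))

  firstPeak-∷ʳ-below : ∀ w s → aboveᵇ A B (step (end w) s) ≡ false → firstPeak (w ∷ʳ s) ≡ firstPeak w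
  firstPeak-∷ʳ-below w s below = firstPeak-∷ʳ w s (peak-∷ʳ-≤ w s (≤-trans height≤0 (0≤peak w)))
    where
    height≤0 : height (w ∷ʳ s) ℤ.≤ 0ℤ
    height≤0 = subst (ℤ._≤ 0ℤ) (trans (cong level (sym (end-∷ʳ w s))) (level-end (w ∷ʳ s)))
                     (level≤0 (step (end w) s) below)

  _along_ : (ℕ × ℕ → ℕ → Bool) → (List Step → ℕ) → List Step → Bool
  (P along S) w = P (end w) (S w)

  Equidistributed : (List Step → ℕ) → (List Step → ℕ) → ℕ → Set
  Equidistributed S₁ S₂ n = ∀ P → count (P along S₁) n ≡ count (P along S₂) n

  module _ (P : ℕ × ℕ → ℕ → Bool) where

    -- P seen from the path before its last step s.
    stepAbove stepBelow : Step → ℕ × ℕ → ℕ → Bool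
    stepAbove s p k = aboveᵇ A B (step p s) ∧ P (step p s) (suc k)
    stepBelow s p k = not (aboveᵇ A B (step p s)) ∧ P (step p s) k

    endsAbove endsBelow : (List Step → ℕ) → List Step → Bool
    endsAbove S w = aboveᵇ A B (end w) ∧ (P along S) w
    endsBelow S w = not (aboveᵇ A B (end w)) ∧ (P along S) w

    -- e w s extends w by the step s, at its end or at its front.
    last-step-decomposition : ∀ S (e : List Step → Step → List Step) →
      (∀ p n → count p (suc n) ≡ sumSteps (λ s → count (λ w → p (e w s)) n)) →
      (∀ w s → end (e w s) ≡ step (end w) s) →
      (∀ w s → aboveᵇ A B (step (end w) s) ≡ true → S (e w s) ≡ suc (S w)) →
      (∀ w s → aboveᵇ A B (step (end w) s) ≡ false → S (w ∷ʳ s) ≡ S w) →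
      ∀ n → count (P along S) (suc n) ≡
            sumSteps (λ s → count (stepAbove s along S) n) +
            sumSteps (λ s → count (stepBelow s along S) n)
    last-step-decomposition S e count-e end-e grows stays n = begin
      count (P along S) (suc n)
        ≡⟨ countᵇ-split (aboveᵇ A B ∘ end) (P along S) (allWords (suc n)) ⟩
      count (endsAbove S) (suc n) + count (endsBelow S) (suc n)
        ≡⟨ cong₂ _+_ (count-e (endsAbove S) n) (count-∷ʳ (endsBelow S) n) ⟩
      sumSteps (λ s → count (λ w → endsAbove S (e w s)) n) +
      sumSteps (λ s → count (λ w → endsBelow S (w ∷ʳ s)) n)
        ≡⟨ cong₂ _+_ (sumSteps-cong λ s → count-cong (endsAbove-e s) n)
                     (sumSteps-cong λ s → count-cong (endsBelow-∷ʳ s) n) ⟩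
      sumSteps (λ s → count (stepAbove s along S) n) +
      sumSteps (λ s → count (stepBelow s along S) n) ∎
      where
      open ≡-Reasoning
      endsAbove-e : ∀ s w → endsAbove S (e w s) ≡ (stepAbove s along S) w
      endsAbove-e s w rewrite end-e w s with aboveᵇ A B (step (end w) s) in above
      ... | true  = cong (P (step (end w) s)) (grows w s above)
      ... | false = refl
      endsBelow-∷ʳ : ∀ s w → endsBelow S (w ∷ʳ s) ≡ (stepBelow s along S) w
      endsBelow-∷ʳ s w rewrite end-∷ʳ w s with aboveᵇ A B (step (end w) s) in above
      ... | true  = refl
      ... | false = cong (P (step (end w) s)) (stays w s above)

  flaws-firstPeak-equidistributed : ∀ n → Equidistributed (flaws A B) firstPeak n
  flaws-firstPeak-equidistributed zero    P = count₀-cong (P along flaws A B) (P along firstPeak) refl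
  flaws-firstPeak-equidistributed (suc n) P = begin
    count (P along flaws A B) (suc n)
      ≡⟨ last-step-decomposition P (flaws A B) _∷ʳ_ count-∷ʳ end-∷ʳ flaws-∷ʳ-above flaws-∷ʳ-below n ⟩
    sumSteps (λ s → count (stepAbove P s along flaws A B) n) +
    sumSteps (λ s → count (stepBelow P s along flaws A B) n)
      ≡⟨ cong₂ _+_ (sumSteps-cong λ s → flaws-firstPeak-equidistributed n (stepAbove P s))
                   (sumSteps-cong λ s → flaws-firstPeak-equidistributed n (stepBelow P s)) ⟩
    sumSteps (λ s → count (stepAbove P s along firstPeak) n) +
    sumSteps (λ s → count (stepBelow P s along firstPeak) n)
      ≡⟨ last-step-decomposition P firstPeak (λ w s → s ∷ w) count-∷ (λ w s → end-∷ s w)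
                                 (λ w s → firstPeak-∷-above s w) firstPeak-∷ʳ-below n ⟨
    count (P along firstPeak) (suc n) ∎
    where open ≡-Reasoning

  cornerWith : ℕ → ℕ × ℕ → ℕ → Bool
  cornerWith k p m = eqPairᵇ p (A , B) ∧ (m ≡ᵇ k)

  firstPeak-shift : 0 < A → ∀ {k} → (∀ u → height u ≡ 0ℤ → length u ≢ suc k) → ∀ n →
    count (cornerWith k along firstPeak) n ≡ count (cornerWith (suc k) along firstPeak) n
  firstPeak-shift 0<A {k} noReturn n = trans (count-rotate _ n) (count-cong rotate-fiber n)
    where
    shift-at-corner : ∀ w → end w ≡ (A , B) → (firstPeak (rotate w) ≡ᵇ k) ≡ (firstPeak w ≡ᵇ suc k)
    shift-at-corner []      end≡AB = contradiction (cong proj₁ end≡AB) (ℕ.<⇒≢ 0<A)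
    shift-at-corner (s ∷ w) end≡AB =
      firstPeak-rotate s w (trans (sym (level-end (s ∷ w))) (trans (cong level end≡AB) level-corner))
                       noReturn

    rotate-fiber : ∀ w →
      (cornerWith k along firstPeak) (rotate w) ≡ (cornerWith (suc k) along firstPeak) w
    rotate-fiber w rewrite endFrom-rotate (0 , 0) w with eqPairᵇ (end w) (A , B) in atCorner
    ... | true  = shift-at-corner w (eqPairᵇ⇒≡ (end w) (A , B) atCorner)
    ... | false = refl

coprime-proportional : ∀ {a b x y} .{{_ : NonZero a}} → Coprime a b → y * a ≡ x * b → (a + b) ∣ x + y
coprime-proportional {a} {b} {x} {y} coprime ya≡xb = divides q (begin
  x + y          ≡⟨ cong₂ _+_ x≡qa y≡qb ⟩
  q * a + q * b  ≡⟨ ℕ.*-distribˡ-+ q a b ⟨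
  q * (a + b)    ∎)
  where
  open ≡-Reasoning
  a∣x : a ∣ x
  a∣x = coprime-divisor coprime (divides y (trans (ℕ.*-comm b x) (sym ya≡xb)))
  q = quotient a∣x
  x≡qa : x ≡ q * a
  x≡qa = _∣_.equality a∣x
  y≡qb : y ≡ q * b
  y≡qb = ℕ.*-cancelʳ-≡ y (q * b) a (begin
    y * a      ≡⟨ ya≡xb ⟩
    x * b      ≡⟨ cong (_* b) x≡qa ⟩
    q * a * b  ≡⟨ xy∙z≈xz∙y q a b ⟩
    q * b * a  ∎)

returns-divisible : ∀ {a b g} .{{_ : NonZero a}} .{{_ : NonZero g}} → Coprime a b →
  ∀ u → Lattice.height (g * a) (g * b) u ≡ 0ℤ → (a + b) ∣ length u
returns-divisible {a} {b} {g} coprime u h≡0 = subst ((a + b) ∣_) (endFrom-length (0 , 0) u)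
  (coprime-proportional {x = x} {y} coprime (ℕ.*-cancelˡ-≡ (y * a) (x * b) g (begin
    g * (y * a)  ≡⟨ x∙yz≈y∙xz g y a ⟩
    y * (g * a)  ≡⟨ returns-proportional u h≡0 ⟩
    x * (g * b)  ≡⟨ x∙yz≈y∙xz x g b ⟩
    g * (x * b)  ∎)))
  where
  open Lattice (g * a) (g * b)
  open ≡-Reasoning
  x = proj₁ (end u)
  y = proj₂ (end u)

constant-on-blocks : ∀ d (f : ℕ → X) → (∀ k → ¬ d ∣ suc k → f (suc k) ≡ f k) →
  ∀ j {k} → j * d ≤ k → k < suc j * d → f k ≡ f (j * d)
constant-on-blocks d f f-step j {k} jd≤k k<[1+j]d =
  subst (λ m → f m ≡ f (j * d)) (ℕ.m+[n∸m]≡n jd≤k) (from-start (k ∸ j * d) offset<d)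
  where
  open ≡-Reasoning
  offset<d : k ∸ j * d < d
  offset<d = ℕ.+-cancelˡ-< (j * d) _ _
    (subst₂ _<_ (sym (ℕ.m+[n∸m]≡n jd≤k)) (ℕ.+-comm d (j * d)) k<[1+j]d)
  from-start : ∀ i → i < d → f (j * d + i) ≡ f (j * d)
  from-start zero    _     = cong f (ℕ.+-identityʳ (j * d))
  from-start (suc i) 1+i<d = begin
    f (j * d + suc i)    ≡⟨ cong f (ℕ.+-suc (j * d) i) ⟩
    f (suc (j * d + i))  ≡⟨ f-step (j * d + i) d∤ ⟩
    f (j * d + i)        ≡⟨ from-start i (ℕ.<-trans (ℕ.n<1+n i) 1+i<d) ⟩
    f (j * d)            ∎
    where
    d∤ : ¬ d ∣ suc (j * d + i)
    d∤ d∣ = ℕ.<⇒≱ 1+i<d (∣⇒≤ (∣m+n∣m⇒∣n (subst (d ∣_) (sym (ℕ.+-suc (j * d) i)) d∣) (n∣m*n j)))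

corollary1p6 : (a b g : ℕ) → 0 < a → 0 < b → gcd a b ≡ 1 → 0 < g →
    (j k : ℕ) → j < g → j * (a + b) ≤ k → k < suc j * (a + b) →
    cardN a b k g ≡ μ a b j g
corollary1p6 a b g 0<a _ gcd≡1 0<g j k _ j[a+b]≤k k<[1+j][a+b] = begin
    cardN a b k g
      ≡⟨ flaws-firstPeak-equidistributed (g * a + g * b) (cornerWith k) ⟩
    peaksAt k
      ≡⟨ constant-on-blocks (a + b) peaksAt shift j j[a+b]≤k k<[1+j][a+b] ⟩
    peaksAt (j * (a + b))
      ≡⟨ flaws-firstPeak-equidistributed (g * a + g * b) (cornerWith (j * (a + b))) ⟨
    μ a b j g ∎
  where
  open ≡-Reasoning
  open Lattice (g * a) (g * b)

  peaksAt : ℕ → ℕ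
  peaksAt m = count (cornerWith m along firstPeak) (g * a + g * b)

  return-lengths : ∀ u → height u ≡ 0ℤ → (a + b) ∣ length u
  return-lengths = returns-divisible {{>-nonZero 0<a}} {{>-nonZero 0<g}} (gcd≡1⇒coprime gcd≡1)

  shift : ∀ m → ¬ (a + b) ∣ suc m → peaksAt (suc m) ≡ peaksAt m
  shift m ∤ = sym (firstPeak-shift (ℕ.*-mono-< 0<g 0<a)
    (λ u h≡0 length≡ → ∤ (subst ((a + b) ∣_) length≡ (return-lengths u h≡0))) (g * a + g * b))
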